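{- Let $P$ be an odd prime, $\alpha$ a positive integer and $A$ an integer with $\alpha\mid A$ and $m:=4A-P>0$. Let $d'$ be a positive integer and put $S:=md'$ and $M:=A/\alpha$. Then there exist positive integers $b',c'$ with $A=\alpha b'c'$ and \[ (4\alpha d'b'-1)(4\alpha d'c'-1)=4\alpha P\,d'^2+1 \] if and only if the quadratic $x^2-Sx+M=0$ has integer roots $b',c'$, i.e.\ $b'+c'=S$ and $b'c'=M$. In particular, in that case the discriminant $\Delta=S^2-4M$ is a perfect square. -}

module Defs where

{-# OPTIONS --safe #-}

-- With x = 4αd′ one has x(b′ + c′) + (xb′ − 1)(xc′ − 1) = x²b′c′ + 1, and, once A = αb′c′, also
-- xS + (4αPd′² + 1) = x²b′c′ + 1.  So the factorisation identity is equivalent to x(b′ + c′) = xS,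
-- i.e. to b′ + c′ = S as x ≠ 0; and A = αb′c′ is b′c′ = M as α ∣ A.  The discriminant is then
-- (b′ + c′)² − 4b′c′ = (b′ − c′)².

module Submission where

open import Defs
open import Data.Nat using (ℕ; NonZero)
open import Data.Nat.Primality using (Prime)
open import Data.Integer using (ℤ; +_; _+_; _-_; _*_; _<_; _/_)
open import Data.Integer.Divisibility using (_∣_)
open import Data.Product using (_×_; ∃)
open import Relation.Binary.PropositionalEquality using (_≡_)
open import Relation.Nullary using (¬_)

import Data.Nat as ℕ
import Data.Nat.Divisibility as ℕ
import Data.Integer as ℤ
open import Data.Integer using (-[1+_]; _%_; 1ℤ)
open import Data.Integer.Properties
  using (+-0-abelianGroup; +-identityˡ; *-assoc; *-comm; *-cancelˡ-≡; i*j≢0)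
open import Data.Integer.DivMod using (a≡a%n+[a/n]*n)
open import Data.Integer.Tactic.RingSolver using (solve-∀)
open import Algebra.Properties.AbelianGroup +-0-abelianGroup using (∙-cancelˡ; ∙-cancelʳ)
open import Data.Product using (_,_)
open import Function.Bundles using (_⇔_; mk⇔; Equivalence)
open import Relation.Binary.PropositionalEquality
  using (refl; sym; trans; cong; cong₂; subst; module ≡-Reasoning)

∣⇒%≡0 : ∀ i α .{{_ : NonZero α}} → + α ∣ i → i % + α ≡ 0
∣⇒%≡0 (+ n)    α α∣n = ℕ.n∣m⇒m%n≡0 n α α∣n
∣⇒%≡0 -[1+ n ] α α∣n with ℕ.suc n ℕ.% α | ℕ.n∣m⇒m%n≡0 (ℕ.suc n) α α∣n
... | ℕ.zero  | _  = refl
... | ℕ.suc _ | ()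

α*[i/α]≡i : ∀ i α .{{_ : NonZero α}} → + α ∣ i → + α * (i / + α) ≡ i
α*[i/α]≡i i α α∣i = begin
  + α * (i / + α)               ≡⟨ *-comm (+ α) (i / + α) ⟩
  i / + α * + α                 ≡⟨ +-identityˡ _ ⟨
  + 0 + i / + α * + α           ≡⟨ cong (λ r → + r + i / + α * + α) (∣⇒%≡0 i α α∣i) ⟨
  + (i % + α) + i / + α * + α   ≡⟨ a≡a%n+[a/n]*n i (+ α) ⟨
  i                             ∎
  where open ≡-Reasoning

∣⇒[≡α*⇔≡/α] : ∀ i α y .{{_ : NonZero α}} → + α ∣ i → i ≡ + α * y ⇔ y ≡ i / + α
∣⇒[≡α*⇔≡/α] i α y α∣i = mk⇔
  (λ i≡αy → *-cancelˡ-≡ (+ α) y (i / + α) (trans (sym i≡αy) (sym (α*[i/α]≡i i α α∣i))))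
  (λ y≡i/α → trans (sym (α*[i/α]≡i i α α∣i)) (cong (_*_ (+ α)) (sym y≡i/α)))

+-common-sum⇒[≡⇔≡] : ∀ {y u z v k : ℤ} → y + u ≡ k → z + v ≡ k → u ≡ v ⇔ y ≡ z
+-common-sum⇒[≡⇔≡] {y} {u} {z} {v} y+u≡k z+v≡k = mk⇔
  (λ u≡v → ∙-cancelʳ v y z (trans (cong (_+_ y) (sym u≡v)) y+u≡z+v))
  (λ y≡z → ∙-cancelˡ z u v (trans (cong (_+ u) (sym y≡z)) y+u≡z+v))
  where
  y+u≡z+v : y + u ≡ z + v
  y+u≡z+v = trans y+u≡k (sym z+v≡k)

sum+shifted-product : ∀ x b c → x * (b + c) + (x * b - 1ℤ) * (x * c - 1ℤ) ≡ x * x * (b * c) + 1ℤ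
sum+shifted-product = solve-∀

shifted-product≡⇔sum≡ : ∀ x b c s v .{{_ : ℤ.NonZero x}} → x * s + v ≡ x * x * (b * c) + 1ℤ →
                        (x * b - 1ℤ) * (x * c - 1ℤ) ≡ v ⇔ b + c ≡ s
shifted-product≡⇔sum≡ x b c s v xs+v≡x²bc+1 = mk⇔
  (λ eq → *-cancelˡ-≡ x (b + c) s (Equivalence.to product⇔scaled-sum eq))
  (λ eq → Equivalence.from product⇔scaled-sum (cong (_*_ x) eq))
  where
  product⇔scaled-sum : (x * b - 1ℤ) * (x * c - 1ℤ) ≡ v ⇔ x * (b + c) ≡ x * s
  product⇔scaled-sum = +-common-sum⇒[≡⇔≡] (sum+shifted-product x b c) xs+v≡x²bc+1

4αd*S-identity : ∀ α P d b c →
  (+ 4 * α * d) * ((+ 4 * (α * b * c) - P) * d) + (+ 4 * α * P * d * d + 1ℤ)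
    ≡ (+ 4 * α * d) * (+ 4 * α * d) * (b * c) + 1ℤ
4αd*S-identity = solve-∀

sum-product-discriminant : ∀ b c → (b + c) * (b + c) - + 4 * (b * c) ≡ (b - c) * (b - c)
sum-product-discriminant = solve-∀

theoremD2 : (P α : ℕ) → Prime P → ¬ (+ 2 ∣ + P) → .{{_ : NonZero α}} → (A : ℤ) → (+ α) ∣ A → + 0 < + 4 * A - + P → (d′ : ℕ) → .{{_ : NonZero d′}} → (b′ c′ : ℤ) → + 0 < b′ → + 0 < c′
    → let S = (+ 4 * A - + P) * + d′
          M = A / + α
      in ((A ≡ + α * b′ * c′ × (+ 4 * + α * + d′ * b′ - + 1) * (+ 4 * + α * + d′ * c′ - + 1) ≡ + 4 * + α * + P * + d′ * + d′ + + 1) → (b′ + c′ ≡ S × b′ * c′ ≡ M))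
       × ((b′ + c′ ≡ S × b′ * c′ ≡ M) → (A ≡ + α * b′ * c′ × (+ 4 * + α * + d′ * b′ - + 1) * (+ 4 * + α * + d′ * c′ - + 1) ≡ + 4 * + α * + P * + d′ * + d′ + + 1))
       × ((b′ + c′ ≡ S × b′ * c′ ≡ M) → ∃ λ k → S * S - + 4 * M ≡ k * k)
theoremD2 P α _ _ A α∣A _ d′ b′ c′ _ _ = forward , backward , discriminant
  where
  S M x rhs : ℤ
  S = (+ 4 * A - + P) * + d′
  M = A / + α
  x = + 4 * + α * + d′
  rhs = + 4 * + α * + P * + d′ * + d′ + 1ℤ

  Factorisation Vieta : Set
  Factorisation = A ≡ + α * b′ * c′ × (x * b′ - 1ℤ) * (x * c′ - 1ℤ) ≡ rhs
  Vieta = b′ + c′ ≡ S × b′ * c′ ≡ M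

  instance
    x≢0 : ℤ.NonZero x
    x≢0 = i*j≢0 (+ 4 * + α) (+ d′) {{i*j≢0 (+ 4) (+ α)}}

  A≡αbc⇔bc≡M : A ≡ + α * b′ * c′ ⇔ b′ * c′ ≡ M
  A≡αbc⇔bc≡M = subst (λ t → A ≡ t ⇔ b′ * c′ ≡ M) (sym (*-assoc (+ α) b′ c′))
                      (∣⇒[≡α*⇔≡/α] A α (b′ * c′) α∣A)

  product⇔sum : A ≡ + α * b′ * c′ → (x * b′ - 1ℤ) * (x * c′ - 1ℤ) ≡ rhs ⇔ b′ + c′ ≡ S
  product⇔sum A≡αbc = shifted-product≡⇔sum≡ x b′ c′ S rhs
    (subst (λ a → x * ((+ 4 * a - + P) * + d′) + rhs ≡ x * x * (b′ * c′) + 1ℤ) (sym A≡αbc)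
           (4αd*S-identity (+ α) (+ P) (+ d′) b′ c′))

  forward : Factorisation → Vieta
  forward (A≡αbc , product≡) =
    Equivalence.to (product⇔sum A≡αbc) product≡ , Equivalence.to A≡αbc⇔bc≡M A≡αbc

  backward : Vieta → Factorisation
  backward (sum≡S , bc≡M) = A≡αbc , Equivalence.from (product⇔sum A≡αbc) sum≡S
    where
    A≡αbc : A ≡ + α * b′ * c′
    A≡αbc = Equivalence.from A≡αbc⇔bc≡M bc≡M

  discriminant : Vieta → ∃ λ k → S * S - + 4 * M ≡ k * k
  discriminant (sum≡S , bc≡M) = b′ - c′ ,
    trans (cong₂ (λ s m → s * s - + 4 * m) (sym sum≡S) (sym bc≡M)) (sum-product-discriminant b′ c′)
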